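{- There exists an undirected, simple temporal graph $\mathcal{G}=(V,E,\lambda)$ such that no directed temporal graph $\mathcal{H}$ on the vertex set $V$ has a non-strict reachability graph isomorphic to the strict reachability graph of $\mathcal{G}$. In other words, some graph in the setting UD \& strict \& simple has no reachability equivalent graph in the setting D \& non-strict.
   Context: A directed (resp. undirected) temporal graph is a triple $(V,E,\lambda)$ with $V$ finite, $E$ a set of arcs $(u,v)$, $u\ne v$ (resp. 2-element subsets of $V$), and $\lambda$ assigning each arc/edge a nonempty finite set of time labels; it is simple if every edge has exactly one label. A temporal path from $u$ to $v$ is a sequence $(e_1,t_1),\dots,(e_k,t_k)$, $k\ge1$, $t_i\in\lambda(e_i)$, with $e_1,\dots,e_k$ a path from $u$ to $v$ in the footprint (distinct vertices, respecting arc directions in the directed case) and $t_1\le\dots\le t_k$; it is strict if $t_1<\dots<t_k$. The strict (resp. non-strict) reachability graph is the static directed graph on $V$ with arc $(u,v)$, $u\ne v$, iff there is a strict (resp. arbitrary) temporal path from $u$ to $v$. Two temporal graphs on the same vertex set are reachability equivalent if their reachability graphs are isomorphic. -}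

module Defs where

open import Data.Nat using (ℕ; _≤_; _<_)
open import Data.Fin using (Fin)
open import Data.Maybe using (Maybe; just; nothing)
open import Data.List using (List; []; _∷_)
open import Data.List.Membership.Propositional using (_∈_)
open import Data.List.Relation.Unary.Unique.Propositional using (Unique)
open import Data.Product using (Σ; _×_; ∃; ∃-syntax)
open import Data.Fin.Permutation using (Permutation′; _⟨$⟩ʳ_)
open import Function.Bundles using (_⇔_)
open import Relation.Binary.PropositionalEquality using (_≡_; _≢_)

-- Undirected simple temporal graph on vertex set Fin n:
-- lab u v = just t  iff  {u,v} is an edge with (unique) label t.
record SimpleUTG (n : ℕ) : Set where
  field
    lab    : Fin n → Fin n → Maybe ℕ
    sym    : ∀ u v → lab u v ≡ lab v u
    irrefl : ∀ u → lab u u ≡ nothing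

-- Directed temporal graph on vertex set Fin n:
-- (u,v) is an arc iff lab u v is nonempty; its label set is the
-- (finite) set of elements of lab u v.
record DTG (n : ℕ) : Set where
  field
    lab    : Fin n → Fin n → List ℕ
    irrefl : ∀ u → lab u u ≡ []

UEdge : ∀ {n} → SimpleUTG n → Fin n → Fin n → ℕ → Set
UEdge G u v t = SimpleUTG.lab G u v ≡ just t

DEdge : ∀ {n} → DTG n → Fin n → Fin n → ℕ → Set
DEdge H u v t = t ∈ DTG.lab H u v

-- Temporal walks: TWalk E ord u v vs t is a sequence of time-edges from u to v
-- with vertex sequence vs (including both endpoints), first label t, and
-- consecutive labels related by ord (_<_ strict, _≤_ non-strict).
data TWalk {n : ℕ} (E : Fin n → Fin n → ℕ → Set) (ord : ℕ → ℕ → Set)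
     : Fin n → Fin n → List (Fin n) → ℕ → Set where
  one  : ∀ {u v t} → E u v t → TWalk E ord u v (u ∷ v ∷ []) t
  cons : ∀ {u w v vs t t'} → E u w t → ord t t' → TWalk E ord w v vs t' →
         TWalk E ord u v (u ∷ vs) t

TPath : ∀ {n} → (Fin n → Fin n → ℕ → Set) → (ℕ → ℕ → Set) → Fin n → Fin n → Set
TPath E ord u v = Σ (List _) λ vs → Σ ℕ λ t → TWalk E ord u v vs t × Unique vs

StrictReachU : ∀ {n} → SimpleUTG n → Fin n → Fin n → Set
StrictReachU G u v = u ≢ v × TPath (UEdge G) _<_ u v

NonStrictReachD : ∀ {n} → DTG n → Fin n → Fin n → Set
NonStrictReachD H u v = u ≢ v × TPath (DEdge H) _≤_ u v

DigraphIso : ∀ {n} → (Fin n → Fin n → Set) → (Fin n → Fin n → Set) → Set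
DigraphIso {n} R S = Σ (Permutation′ n) λ π → ∀ u v → R u v ⇔ S (π ⟨$⟩ʳ u) (π ⟨$⟩ʳ v)

-- Take for G the 4-cycle a₀a₁a₂a₃ with every edge labelled 0: strict paths cannot use two edges,
-- so its strict reachability graph is the cycle itself, i.e. the complete bipartite graph K₂,₂.
-- Suppose a directed H has this as its non-strict reachability graph. Since K₂,₂ is triangle-free,
-- every reachable pair of H is joined by an arc. Along each induced path a → b → c of the square,
-- c is not reachable from a, so the label of bc is smaller than that of ab. Going round the square
-- the arc labels would strictly decrease four times and return to where they started.
module Submission where

open import Defs
open import Data.Bool using (Bool; true; false; _xor_; if_then_else_)
open import Data.Bool.Properties using (xor-comm; xor-same)
open import Data.Nat using (ℕ; _<_)
open import Data.Nat.Properties using (<-irrefl; ≰⇒>; _≤?_; module ≤-Reasoning)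
open import Data.Fin using (Fin)
open import Data.Fin.Patterns using (0F; 1F; 2F; 3F)
open import Data.Fin.Permutation using (_⟨$⟩ʳ_; _⟨$⟩ˡ_; inverseʳ; flip)
open import Data.Maybe using (Maybe; just; nothing)
open import Data.Maybe.Properties using (just-injective)
open import Data.List using ([]; _∷_)
open import Data.List.Membership.Propositional using (_∈_)
open import Data.List.Relation.Unary.Any using (here; there)
open import Data.List.Relation.Unary.Any.Properties using (¬Any[])
open import Data.List.Relation.Unary.All using ([]; _∷_; lookup)
open import Data.List.Relation.Unary.AllPairs using ([]; _∷_)
open import Data.List.Relation.Unary.Unique.Propositional using (Unique)
open import Data.Product using (Σ; ∃; _,_)
open import Data.Empty using (⊥)
open import Function.Bundles using (_⇔_; mk⇔; Equivalence; Injection)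
open import Function.Base using (_∘_)
open import Function.Construct.Composition using (_⇔-∘_)
open import Function.Properties.Inverse using (↔⇒↣)
open import Relation.Nullary using (¬_; yes; no; contradiction)
open import Relation.Binary.PropositionalEquality using (_≡_; _≢_; refl; sym; trans; cong; cong₂; subst)

module _ {n : ℕ} {E : Fin n → Fin n → ℕ → Set} {ord : ℕ → ℕ → Set} where

  walk-first-edge : ∀ {u v vs t} → TWalk E ord u v vs t → ∃ λ w → E u w t
  walk-first-edge (one e)      = _ , e
  walk-first-edge (cons e _ _) = _ , e

  walk-target-∈ : ∀ {u v vs t} → TWalk E ord u v vs t → v ∈ vs
  walk-target-∈ (one _)      = there (here refl)
  walk-target-∈ (cons _ _ w) = there (walk-target-∈ w)

  walk-ends-distinct : ∀ {u v vs t} → TWalk E ord u v vs t → Unique vs → u ≢ v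
  walk-ends-distinct (one _)      ((u≢v ∷ []) ∷ _) = u≢v
  walk-ends-distinct (cons _ _ w) (u∉vs ∷ _)       = lookup u∉vs (walk-target-∈ w)

  edge-path : ∀ {u v t} → E u v t → u ≢ v → TPath E ord u v
  edge-path e u≢v = _ , _ , one e , (u≢v ∷ []) ∷ [] ∷ []

  two-edge-path : ∀ {x y z t t'} → E x y t → ord t t' → E y z t' →
                  x ≢ y → x ≢ z → y ≢ z → TPath E ord x z
  two-edge-path e o e' x≢y x≢z y≢z =
    _ , _ , cons e o (one e') , (x≢y ∷ x≢z ∷ []) ∷ (y≢z ∷ []) ∷ [] ∷ []

module _ {n : ℕ} (G : SimpleUTG n) where

  uedge-distinct : ∀ {u v t} → UEdge G u v t → u ≢ v
  uedge-distinct {u} e refl with trans (sym e) (SimpleUTG.irrefl G u)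
  ... | ()

  strictReach⇔edge : ∀ {c} → (∀ {u v t} → UEdge G u v t → t ≡ c) →
                     ∀ u v → StrictReachU G u v ⇔ ∃ (UEdge G u v)
  strictReach⇔edge single u v = mk⇔ to from
    where
    to : StrictReachU G u v → ∃ (UEdge G u v)
    to (_ , _ , t , one e , _) = t , e
    to (_ , _ , _ , cons e t<t' w , _) with walk-first-edge w
    ... | _ , e' with single e | single e'
    ... | refl | refl = contradiction t<t' (<-irrefl refl)

    from : ∃ (UEdge G u v) → StrictReachU G u v
    from (_ , e) = uedge-distinct e , edge-path e (uedge-distinct e)

module _ {n : ℕ} (κ : Fin n → Bool) where

  completeBipartite : SimpleUTG n
  completeBipartite = record
    { lab    = λ u v → edgeIf (κ u xor κ v)
    ; sym    = λ u v → cong edgeIf (xor-comm (κ u) (κ v))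
    ; irrefl = λ u → cong edgeIf (xor-same (κ u))
    }
    where
    edgeIf : Bool → Maybe ℕ
    edgeIf b = if b then just 0 else nothing

  completeBipartite-label : ∀ {u v t} → UEdge completeBipartite u v t → t ≡ 0
  completeBipartite-label {u} {v} e with κ u xor κ v
  ... | true = sym (just-injective e)

  completeBipartite-edge⇔ : ∀ u v → ∃ (UEdge completeBipartite u v) ⇔ (κ u xor κ v ≡ true)
  completeBipartite-edge⇔ u v = mk⇔ to from
    where
    to : ∃ (UEdge completeBipartite u v) → κ u xor κ v ≡ true
    to e with κ u xor κ v
    ... | true = refl

    from : κ u xor κ v ≡ true → ∃ (UEdge completeBipartite u v)
    from p rewrite p = 0 , refl

  completeBipartite-strictReach⇔ : ∀ u v → StrictReachU completeBipartite u v ⇔ (κ u xor κ v ≡ true)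
  completeBipartite-strictReach⇔ u v =
    completeBipartite-edge⇔ u v ⇔-∘ strictReach⇔edge completeBipartite completeBipartite-label u v

xor-triangle-free : ∀ a b c → a xor b ≡ true → b xor c ≡ true → a xor c ≢ true
xor-triangle-free false true false _ _ ()
xor-triangle-free true false true  _ _ ()

darc-distinct : ∀ {n} (H : DTG n) {x y t} → DEdge H x y t → x ≢ y
darc-distinct H {x} t∈ refl = ¬Any[] (subst (_ ∈_) (DTG.irrefl H x) t∈)

module _ {n : ℕ} (H : DTG n) (κ : Fin n → Bool)
         (reach⇔ : ∀ x y → NonStrictReachD H x y ⇔ (κ x xor κ y ≡ true)) where

  private
    reach→ : ∀ {x y} → NonStrictReachD H x y → κ x xor κ y ≡ true
    reach→ {x} {y} = Equivalence.to (reach⇔ x y)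

    reach← : ∀ {x y} → κ x xor κ y ≡ true → NonStrictReachD H x y
    reach← {x} {y} = Equivalence.from (reach⇔ x y)

  reach-arc : ∀ {x y} → κ x xor κ y ≡ true → ∃ (DEdge H x y)
  reach-arc {x} {y} xy with reach← xy
  ... | _ , _ , t , one e , _ = t , e
  ... | _ , _ , _ , cons {w = w} e _ walk , _ ∷ uniq =
    contradiction xy (xor-triangle-free (κ x) (κ w) (κ y) (reach→ x→w) (reach→ w→y))
    where
    x→w : NonStrictReachD H x w
    x→w = darc-distinct H e , edge-path e (darc-distinct H e)

    w→y : NonStrictReachD H w y
    w→y = walk-ends-distinct walk uniq , _ , _ , walk , uniq

  arc-labels-descend : ∀ {x y z t t'} → κ x xor κ y ≡ true → κ y xor κ z ≡ true → x ≢ z →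
                       DEdge H x y t → DEdge H y z t' → t' < t
  arc-labels-descend {x} {y} {z} {t} {t'} xy yz x≢z e e' with t ≤? t'
  ... | no t≰t' = ≰⇒> t≰t'
  ... | yes t≤t' = contradiction (reach→ (x≢z , two-edge-path e t≤t' e'
                     (darc-distinct H e) x≢z (darc-distinct H e')))
                     (xor-triangle-free (κ x) (κ y) (κ z) xy yz)

  no-reachable-square : ∀ {a b c d} →
    κ a xor κ b ≡ true → κ b xor κ c ≡ true → κ c xor κ d ≡ true → κ d xor κ a ≡ true →
    a ≢ c → b ≢ d → ⊥
  no-reachable-square ab bc cd da a≢c b≢d
    with reach-arc ab | reach-arc bc | reach-arc cd | reach-arc da
  ... | tab , eab | tbc , ebc | tcd , ecd | tda , eda = <-irrefl refl (begin-strict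
    tab  <⟨ arc-labels-descend da ab (b≢d ∘ sym) eda eab ⟩
    tda  <⟨ arc-labels-descend cd da (a≢c ∘ sym) ecd eda ⟩
    tcd  <⟨ arc-labels-descend bc cd b≢d ebc ecd ⟩
    tbc  <⟨ arc-labels-descend ab bc a≢c eab ebc ⟩
    tab  ∎)
    where open ≤-Reasoning

parity : Fin 4 → Bool
parity 0F = false
parity 1F = true
parity 2F = false
parity 3F = true

lemma24 : Σ ℕ λ n → Σ (SimpleUTG n) λ G →
    (H : DTG n) → ¬ DigraphIso (NonStrictReachD H) (StrictReachU G)
lemma24 = 4 , completeBipartite parity , no-equivalent
  where
  no-equivalent : (H : DTG 4) → ¬ DigraphIso (NonStrictReachD H) (StrictReachU (completeBipartite parity))
  no-equivalent H (π , iso) = no-reachable-square H κ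
    (λ x y → completeBipartite-strictReach⇔ parity _ _ ⇔-∘ iso x y)
    (κ-corner 0F 1F) (κ-corner 1F 2F) (κ-corner 2F 3F) (κ-corner 3F 0F)
    (λ p → contradiction (corner-injective p) λ ())
    (λ p → contradiction (corner-injective p) λ ())
    where
    κ : Fin 4 → Bool
    κ x = parity (π ⟨$⟩ʳ x)

    corner : Fin 4 → Fin 4
    corner i = π ⟨$⟩ˡ i

    κ-corner : ∀ i j → κ (corner i) xor κ (corner j) ≡ parity i xor parity j
    κ-corner i j = cong₂ (λ p q → parity p xor parity q) (inverseʳ π) (inverseʳ π)

    corner-injective : ∀ {i j} → corner i ≡ corner j → i ≡ j
    corner-injective = Injection.injective (↔⇒↣ (flip π))
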